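{- For all integers $\Delta\geq d\geq3$, every caterpillar $T$ with maximum degree at most $\Delta$ has a covering by $\lceil\frac{\Delta-2}{d-2}\rceil$ subtrees of maximum degree at most $d$. Conversely, for all integers $\Delta\geq d\geq3$, there are infinitely many caterpillars $T$ with maximum degree at most $\Delta$ such that every covering of $T$ by subtrees of maximum degree at most $d$ uses at least $\lceil\frac{\Delta-2}{d-2}\rceil$ subtrees.
   Context: A caterpillar is a tree for which a path is obtained by deleting the leaves. A covering of a graph is a set of connected subgraphs such that every edge is in at least one subgraph. -}

module Defs where

open import Data.Nat using (ℕ; zero; suc; _+_; _*_; _∸_; _≤_)
open import Data.Nat.DivMod using (_/_)
open import Data.Bool using (Bool; true; false; if_then_else_)
open import Data.Fin using (Fin; zero; suc; toℕ; inject₁; fromℕ)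
open import Data.List using (List; []; _∷_; map; allFin)
open import Data.Nat.ListAction using (sum)
open import Data.Product using (Σ; ∃; _×_; _,_)
open import Data.Sum using (_⊎_)
open import Data.Empty using (⊥)
open import Relation.Nullary using (¬_)
open import Relation.Binary.PropositionalEquality using (_≡_)
open import Function.Definitions using (Injective)

-- ⌈ a / b ⌉ for natural numbers (b > 0); value 0 when b = 0 (never used).
ceilDiv : ℕ → ℕ → ℕ
ceilDiv a zero    = 0
ceilDiv a (suc b) = (a + b) / suc b

record Graph (n : ℕ) : Set where
  field
    adj    : Fin n → Fin n → Bool
    sym    : ∀ u v → adj u v ≡ adj v u
    irrefl : ∀ v → adj v v ≡ false
open Graph public

VSet : ℕ → Set
VSet n = Fin n → Bool

ERel : ℕ → Set
ERel n = Fin n → Fin n → Bool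

degree : ∀ {n} → ERel n → Fin n → ℕ
degree {n} E v = sum (map (λ w → if E v w then 1 else 0) (allFin n))

MaxDegAtMost : ∀ {n} → ERel n → ℕ → Set
MaxDegAtMost E d = ∀ v → degree E v ≤ d

data Walk {n : ℕ} (E : ERel n) : Fin n → Fin n → Set where
  here : ∀ {u} → Walk E u u
  step : ∀ {u v w} → E u v ≡ true → Walk E v w → Walk E u w

Connected : ∀ {n} → VSet n → ERel n → Set
Connected W E = ∀ u v → W u ≡ true → W v ≡ true → Walk E u v

-- a cycle of length m+3: distinct vertices c₀,…,c_{m+2}, consecutive ones
-- adjacent and c_{m+2} adjacent to c₀
record Cycle {n : ℕ} (E : ERel n) : Set where
  field
    m      : ℕ
    c      : Fin (suc (suc (suc m))) → Fin n
    inj    : Injective _≡_ _≡_ c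
    consec : ∀ (i : Fin (suc (suc m))) → E (c (inject₁ i)) (c (suc i)) ≡ true
    close  : E (c (fromℕ (suc (suc m)))) (c zero) ≡ true

Acyclic : ∀ {n} → ERel n → Set
Acyclic E = ¬ Cycle E

IsTree : ∀ {n} → VSet n → ERel n → Set
IsTree W E = (∃ λ v → W v ≡ true) × Connected W E × Acyclic E

allV : ∀ {n} → VSet n
allV _ = true

Tree : ∀ {n} → Graph n → Set
Tree G = IsTree allV (adj G)

isLeaf : ∀ {n} → Graph n → Fin n → Bool
isLeaf G v with degree (adj G) v
... | 1 = true
... | _ = false

notLeaf : ∀ {n} → Graph n → VSet n
notLeaf G v = if isLeaf G v then false else true

-- (W , E) is a path graph: its vertices can be listed (without repetition)
-- as p₀,…,p_{k-1} such that two vertices of W are adjacent iff consecutive.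
-- (k = 0, the empty graph, is allowed.)
IsPath : ∀ {n} → VSet n → ERel n → Set
IsPath {n} W E =
  Σ ℕ λ k → Σ (Fin k → Fin n) λ p →
    Injective _≡_ _≡_ p
    × (∀ i → W (p i) ≡ true)
    × (∀ v → W v ≡ true → ∃ λ i → p i ≡ v)
    × (∀ i j → (E (p i) (p j) ≡ true → (toℕ i ≡ suc (toℕ j) ⊎ toℕ j ≡ suc (toℕ i)))
              × ((toℕ i ≡ suc (toℕ j) ⊎ toℕ j ≡ suc (toℕ i)) → E (p i) (p j) ≡ true))

induced : ∀ {n} → ERel n → VSet n → ERel n
induced E W u v = if W u then (if W v then E u v else false) else false

Caterpillar : ∀ {n} → Graph n → Set
Caterpillar G = Tree G × IsPath (notLeaf G) (induced (adj G) (notLeaf G))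

record Subgraph {n : ℕ} (G : Graph n) : Set where
  field
    vs      : VSet n
    es      : ERel n
    es-sym  : ∀ u v → es u v ≡ es v u
    es-adj  : ∀ u v → es u v ≡ true → adj G u v ≡ true
    es-vs   : ∀ u v → es u v ≡ true → vs u ≡ true
open Subgraph public

IsSubtreeMaxDeg : ∀ {n} {G : Graph n} → ℕ → Subgraph G → Set
IsSubtreeMaxDeg d H = IsTree (vs H) (es H) × MaxDegAtMost (es H) d

Covers : ∀ {n k} (G : Graph n) → (Fin k → Subgraph G) → Set
Covers {n} {k} G H = ∀ u v → adj G u v ≡ true → ∃ λ (i : Fin k) → es (H i) u v ≡ true

module Submission where

-- (1) Every subtree contains the whole spine (the path left after deleting the leaves).  A spine
-- vertex v with s ≤ 2 spine neighbours can keep d - s of its leaves in each subtree; numbering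
-- the leaves of v, the r-th one goes to subtree ⌊r/(d-s)⌋, and Δ - s ≤ K(d-s) makes K enough.
-- (2) Take a spine of M > 2K vertices, each with Δ - 2 leaves.  In a covering by k < K subtrees
-- each subtree meets the spine in a path with two ends, so some spine vertex v is an end of no
-- subtree; every subtree through v then uses both spine edges at v and keeps at most d - 2 of
-- its Δ - 2 leaves, whence Δ - 2 ≤ k(d-2), a contradiction.

open import Defs hiding (sym)
open import Data.Nat
open import Data.Nat.Properties
open import Data.Nat.DivMod using (_/_; _%_; m≡m%n+[m/n]*n; m%n<n; m/n*n≤m; m≥n⇒m/n>0; m<n*o⇒m/o<n)
open import Data.Bool using (Bool; true; false; if_then_else_; _∧_; _∨_; not) renaming (_≟_ to _≟ᵇ_)
open import Data.Bool.Properties using (∨-comm; ∨-identityʳ; ∧-identityʳ; ∧-zeroʳ; T-≡)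
open import Function.Bundles using (Equivalence)
open import Data.Fin using (Fin; zero; suc; toℕ; inject₁; fromℕ; fromℕ<; combine; remQuot)
open import Data.Fin.Properties using (any?; toℕ-injective; toℕ<n; toℕ-inject₁; toℕ-fromℕ; toℕ-fromℕ<;
  remQuot-combine; combine-remQuot; combine-injectiveˡ; combine-injectiveʳ)
  renaming (suc-injective to Fin-suc-injective; _≟_ to _≟ᶠ_)
open import Data.List using (tabulate)
open import Data.List.Properties using (map-tabulate)
open import Data.Nat.ListAction using (sum)
open import Data.Product using (Σ; ∃; _×_; _,_; proj₁; proj₂; uncurry)
open import Data.Sum using (_⊎_; inj₁; inj₂)
open import Data.Empty using (⊥; ⊥-elim)
open import Relation.Nullary using (¬_; Dec; yes; no; does)
open import Relation.Binary.PropositionalEquality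
open import Function using (_∘_; id)
open import Data.Vec.Functional using ([]; _∷_)
open import Function.Definitions using (Injective)

∧-left : ∀ a {b} → a ∧ b ≡ true → a ≡ true
∧-left true _ = refl

∧-right : ∀ a {b} → a ∧ b ≡ true → b ≡ true
∧-right true h = h

∨-left : ∀ {a} b → a ≡ true → a ∨ b ≡ true
∨-left b refl = refl

∨-right : ∀ a {b} → b ≡ true → a ∨ b ≡ true
∨-right true  _ = refl
∨-right false h = h

true-or-false : ∀ b → b ≡ true ⊎ b ≡ false
true-or-false true  = inj₁ refl
true-or-false false = inj₂ refl

∨-cases : ∀ a {b} → a ∨ b ≡ true → a ≡ true ⊎ b ≡ true
∨-cases true  _ = inj₁ refl
∨-cases false h = inj₂ h

∧-not : ∀ a b → a ∧ not b ≡ true → a ≡ true × b ≡ false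
∧-not true false _ = refl , refl

∧-not-false : ∀ {a} b → a ≡ true → a ∧ not b ≡ false → b ≡ true
∧-not-false true refl _ = refl

∨-false : ∀ a b → a ∨ b ≡ false → a ≡ false × b ≡ false
∨-false false false _ = refl , refl

false≢true : false ≡ true → ⊥
false≢true ()

≡ᵇ-sound : ∀ x y → (x ≡ᵇ y) ≡ true → x ≡ y
≡ᵇ-sound x y e = ≡ᵇ⇒≡ x y (Equivalence.from T-≡ e)

≡ᵇ-complete : ∀ {x y} → x ≡ y → (x ≡ᵇ y) ≡ true
≡ᵇ-complete {x} {y} e = Equivalence.to T-≡ (≡⇒≡ᵇ x y e)

≢ᵇ-suc : ∀ x → (x ≡ᵇ suc x) ≡ false
≢ᵇ-suc zero    = refl
≢ᵇ-suc (suc x) = ≢ᵇ-suc x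

n≢2+n : ∀ {x : ℕ} → ¬ x ≡ suc (suc x)
n≢2+n ()

𝟙 : Bool → ℕ
𝟙 b = if b then 1 else 0

∑ : ∀ n → (Fin n → ℕ) → ℕ
∑ zero    f = 0
∑ (suc n) f = f zero + ∑ n (f ∘ suc)

count : ∀ {n} → (Fin n → Bool) → ℕ
count {n} P = ∑ n (𝟙 ∘ P)

_==_ : ∀ {n} → Fin n → Fin n → Bool
a == b = does (a ≟ᶠ b)

degree≡count : ∀ {n} (E : ERel n) v → degree E v ≡ count (E v)
degree≡count {n} E v = trans (cong sum (map-tabulate id (𝟙 ∘ E v))) (sum-tabulate n (𝟙 ∘ E v))
  where
  sum-tabulate : ∀ n (f : Fin n → ℕ) → sum (tabulate f) ≡ ∑ n f
  sum-tabulate zero    f = refl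
  sum-tabulate (suc n) f = cong (f zero +_) (sum-tabulate n (f ∘ suc))

∑-cong : ∀ n {f g : Fin n → ℕ} → (∀ i → f i ≡ g i) → ∑ n f ≡ ∑ n g
∑-cong zero    p = refl
∑-cong (suc n) p = cong₂ _+_ (p zero) (∑-cong n (p ∘ suc))

∑-mono : ∀ n {f g : Fin n → ℕ} → (∀ i → f i ≤ g i) → ∑ n f ≤ ∑ n g
∑-mono zero    p = ≤-refl
∑-mono (suc n) p = +-mono-≤ (p zero) (∑-mono n (p ∘ suc))

∑-+ : ∀ n (f g : Fin n → ℕ) → ∑ n (λ i → f i + g i) ≡ ∑ n f + ∑ n g
∑-+ zero    f g = refl
∑-+ (suc n) f g = trans (cong (f zero + g zero +_) (∑-+ n (f ∘ suc) (g ∘ suc)))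
                        (+-interchange (f zero) (g zero) _ _)
  where open import Algebra.Properties.CommutativeSemigroup +-commutativeSemigroup
          using () renaming (interchange to +-interchange)

∑-const : ∀ n c → ∑ n (λ _ → c) ≡ n * c
∑-const zero    c = refl
∑-const (suc n) c = cong (c +_) (∑-const n c)

∑-zero : ∀ n → ∑ n (λ _ → 0) ≡ 0
∑-zero n = trans (∑-const n 0) (*-zeroʳ n)

∑-ones : ∀ n → ∑ n (λ _ → 1) ≡ n
∑-ones n = trans (∑-const n 1) (*-identityʳ n)

∑-swap : ∀ n m (f : Fin n → Fin m → ℕ) →
  ∑ n (λ i → ∑ m (f i)) ≡ ∑ m (λ j → ∑ n (λ i → f i j))
∑-swap zero    m f = sym (∑-zero m)
∑-swap (suc n) m f = trans (cong (∑ m (f zero) +_) (∑-swap n m (f ∘ suc)))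
                           (sym (∑-+ m (f zero) (λ j → ∑ n (λ i → f (suc i) j))))

∑-term : ∀ n (f : Fin n → ℕ) i → f i ≤ ∑ n f
∑-term (suc n) f zero    = m≤m+n _ _
∑-term (suc n) f (suc i) = ≤-trans (∑-term n (f ∘ suc) i) (m≤n+m _ _)

∑-bound : ∀ n {f : Fin n → ℕ} c → (∀ i → f i ≤ c) → ∑ n f ≤ n * c
∑-bound n c p = ≤-trans (∑-mono n p) (≤-reflexive (∑-const n c))

==-sound : ∀ {n} (a b : Fin n) → a == b ≡ true → a ≡ b
==-sound a b e with a ≟ᶠ b
... | yes a≡b = a≡b

==-refl : ∀ {n} (a : Fin n) → a == a ≡ true
==-refl a with a ≟ᶠ a
... | yes _   = refl
... | no a≢a = ⊥-elim (a≢a refl)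

count-== : ∀ {n} (a : Fin n) → count (_== a) ≡ 1
count-== {suc n} zero    = cong suc (∑-zero n)
count-== {suc n} (suc a) = count-== a

count-image : ∀ {n m} (P : Fin n → Bool) (g : Fin m → Fin n) →
  (∀ w → P w ≡ true → ∃ λ t → g t ≡ w) → count P ≤ m
count-image {n} {m} P g cover = begin
  ∑ n (𝟙 ∘ P)                            ≤⟨ ∑-mono n hit ⟩
  ∑ n (λ w → ∑ m (λ t → 𝟙 (w == g t)))  ≡⟨ ∑-swap n m _ ⟩
  ∑ m (λ t → count (_== g t))            ≡⟨ ∑-cong m (count-== ∘ g) ⟩
  ∑ m (λ _ → 1)                          ≡⟨ ∑-ones m ⟩
  m                                      ∎
  where
  open ≤-Reasoning
  hit : ∀ w → 𝟙 (P w) ≤ ∑ m (λ t → 𝟙 (w == g t))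
  hit w with P w in pw
  ... | false = z≤n
  ... | true with cover w pw
  ... | t , refl = subst (λ b → 𝟙 b ≤ ∑ m (λ t' → 𝟙 (g t == g t'))) (==-refl (g t))
                          (∑-term m (λ t' → 𝟙 (g t == g t')) t)

exists? : ∀ {n} (P : Fin n → Bool) → Dec (∃ λ w → P w ≡ true)
exists? P = any? (λ w → P w ≟ᵇ true)

count≤1 : ∀ {n} (P : Fin n → Bool) → (∀ a b → P a ≡ true → P b ≡ true → a ≡ b) → count P ≤ 1
count≤1 P unique with exists? P
... | yes (a , pa) = count-image P (λ _ → a) (λ w pw → zero , unique a w pa pw)
... | no none      = ≤-trans (count-image P (λ ()) (λ w pw → ⊥-elim (none (w , pw)))) z≤n

count-==-∧ : ∀ {n} (a : Fin n) (P : Fin n → Bool) → count (λ w → (w == a) ∧ P w) ≡ 𝟙 (P a)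
count-==-∧ {suc n} zero    P = trans (cong (𝟙 (P zero) +_) (∑-zero n)) (+-identityʳ _)
count-==-∧ {suc n} (suc a) P = count-==-∧ a (P ∘ suc)

count-∘-injective : ∀ {n m} (P : Fin n → Bool) (g : Fin m → Fin n) → Injective _≡_ _≡_ g →
  count (P ∘ g) ≤ count P
count-∘-injective {n} {m} P g inj = begin
  ∑ m (λ t → 𝟙 (P (g t)))                             ≡⟨ sym (∑-cong m λ t → count-==-∧ (g t) P) ⟩
  ∑ m (λ t → count (λ w → (w == g t) ∧ P w))          ≡⟨ sym (∑-swap n m _) ⟩
  ∑ n (λ w → count (λ t → (w == g t) ∧ P w))          ≤⟨ ∑-mono n fibre ⟩
  ∑ n (𝟙 ∘ P)                                          ∎
  where
  open ≤-Reasoning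
  fibre : ∀ w → count (λ t → (w == g t) ∧ P w) ≤ 𝟙 (P w)
  fibre w with P w
  ... | true  = subst (_≤ 1) (∑-cong m λ t → cong 𝟙 (sym (∧-identityʳ (w == g t))))
                  (count≤1 _ (λ a b ea eb → inj (trans (sym (==-sound w (g a) ea)) (==-sound w (g b) eb))))
  ... | false = ≤-reflexive (trans (∑-cong m λ t → cong 𝟙 (∧-zeroʳ (w == g t)))
                                   (∑-zero m))

count-injective : ∀ {n m} (P : Fin n → Bool) (g : Fin m → Fin n) → Injective _≡_ _≡_ g →
  (∀ t → P (g t) ≡ true) → m ≤ count P
count-injective {m = m} P g inj all-P = begin
  m                        ≡⟨ sym (∑-ones m) ⟩
  ∑ m (λ _ → 1)            ≡⟨ sym (∑-cong m (cong 𝟙 ∘ all-P)) ⟩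
  count (P ∘ g)            ≤⟨ count-∘-injective P g inj ⟩
  count P                  ∎
  where open ≤-Reasoning

anyᵇ : ∀ {n} → (Fin n → Bool) → Bool
anyᵇ P = does (exists? P)

anyᵇ-intro : ∀ {n} (P : Fin n → Bool) w → P w ≡ true → anyᵇ P ≡ true
anyᵇ-intro P w pw with exists? P
... | yes _    = refl
... | no none  = ⊥-elim (none (w , pw))

anyᵇ-elim : ∀ {n} (P : Fin n → Bool) → anyᵇ P ≡ true → ∃ λ w → P w ≡ true
anyᵇ-elim P e with exists? P
... | yes witness = witness

𝟙-anyᵇ : ∀ {n} (P : Fin n → Bool) → 𝟙 (anyᵇ P) ≤ count P
𝟙-anyᵇ {n} P with exists? P
... | no _         = z≤n
... | yes (w , pw) = ≤-trans (≤-reflexive (cong 𝟙 (sym pw))) (∑-term n (𝟙 ∘ P) w)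

count≥2 : ∀ {n} (P : Fin n → Bool) {a b} → ¬ a ≡ b → P a ≡ true → P b ≡ true → 2 ≤ count P
count≥2 P {a} {b} a≢b pa pb = count-injective P (a ∷ b ∷ []) injective λ { zero → pa ; (suc zero) → pb }
  where
  injective : Injective _≡_ _≡_ (a ∷ b ∷ [])
  injective {zero}     {zero}     _ = refl
  injective {zero}     {suc zero} e = ⊥-elim (a≢b e)
  injective {suc zero} {zero}     e = ⊥-elim (a≢b (sym e))
  injective {suc zero} {suc zero} _ = refl

count≤2 : ∀ {n} (P : Fin n → Bool) a b → (∀ w → P w ≡ true → w ≡ a ⊎ w ≡ b) → count P ≤ 2
count≤2 P a b only = count-image P (a ∷ b ∷ []) λ w pw → case-ab (only w pw)
  where
  case-ab : ∀ {w} → w ≡ a ⊎ w ≡ b → ∃ λ t → (a ∷ b ∷ []) t ≡ w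
  case-ab (inj₁ refl) = zero , refl
  case-ab (inj₂ refl) = suc zero , refl

_++ʷ_ : ∀ {n} {E : ERel n} {u v w} → Walk E u v → Walk E v w → Walk E u w
here       ++ʷ q = q
step e p ++ʷ q = step e (p ++ʷ q)

reverseʷ : ∀ {n} {E : ERel n} → (∀ u v → E u v ≡ E v u) → ∀ {u v} → Walk E u v → Walk E v u
reverseʷ E-sym here       = here
reverseʷ E-sym (step e p) = reverseʷ E-sym p ++ʷ step (trans (E-sym _ _) e) here

Consecutive : ∀ {n m} → ERel n → (Fin m → Fin n) → Set
Consecutive {m = m} E p = ∀ (i j : Fin m) → toℕ j ≡ suc (toℕ i) → E (p i) (p j) ≡ true

pathWalk : ∀ {n m} (E : ERel n) → (∀ u v → E u v ≡ E v u) → (p : Fin m → Fin n) →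
  Consecutive E p → ∀ a b → Walk E (p a) (p b)
pathWalk {n} {suc m} E E-sym p consecutive a b =
  reverseʷ E-sym (fromStart p consecutive a) ++ʷ fromStart p consecutive b
  where
  fromStart : ∀ {m} (p : Fin (suc m) → Fin n) → Consecutive E p → ∀ b → Walk E (p zero) (p b)
  fromStart p cons zero    = here
  fromStart {suc m} p cons (suc b) =
    step (cons zero (suc zero) refl) (fromStart (p ∘ suc) (λ i j e → cons (suc i) (suc j) (cong suc e)) b)

acyclic-sub : ∀ {n} {E E' : ERel n} → (∀ u v → E' u v ≡ true → E u v ≡ true) → Acyclic E → Acyclic E'
acyclic-sub E'⊆E acyclic C = acyclic record
  { m = Cycle.m C ; c = Cycle.c C ; inj = Cycle.inj C
  ; consec = λ i → E'⊆E _ _ (Cycle.consec C i) ; close = E'⊆E _ _ (Cycle.close C) }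

argmax : ∀ {K} (f : Fin (suc K) → ℕ) → Σ (Fin (suc K)) λ t → ∀ s → f s ≤ f t
argmax {zero}  f = zero , λ { zero → ≤-refl }
argmax {suc K} f with argmax (f ∘ suc)
... | t , max with f zero ≤? f (suc t)
... | yes f0≤ = suc t , λ { zero → f0≤ ; (suc s) → max s }
... | no  f0≰ = zero  , λ { zero → ≤-refl ; (suc s) → ≤-trans (max s) (<⇒≤ (≰⇒> f0≰)) }

module _ {n} {E : ERel n} (E-sym : ∀ u v → E u v ≡ E v u) (C : Cycle E) where
  open Cycle C

  private
    last : Fin (suc (suc (suc m)))
    last = fromℕ (suc (suc m))

  cycle-edge : ∀ a b → toℕ b ≡ suc (toℕ a) → E (c a) (c b) ≡ true
  cycle-edge a b b≡a+1 = subst₂ (λ x y → E (c x) (c y) ≡ true)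
    (toℕ-injective (trans (toℕ-inject₁ i) (toℕ-fromℕ< a<)))
    (toℕ-injective (trans (cong suc (toℕ-fromℕ< a<)) (sym b≡a+1)))
    (consec i)
    where
    a< : toℕ a < suc (suc m)
    a< = s≤s⁻¹ (subst (_< suc (suc (suc m))) b≡a+1 (toℕ<n b))
    i : Fin (suc (suc m))
    i = fromℕ< a<

  cycle-edge-back : ∀ t → E (c (suc t)) (c (inject₁ t)) ≡ true
  cycle-edge-back t = trans (E-sym _ _) (cycle-edge (inject₁ t) (suc t) (cong suc (sym (toℕ-inject₁ t))))

  cycle-neighbours : ∀ t → Σ _ λ a → Σ _ λ b → ¬ a ≡ b × E (c t) (c a) ≡ true × E (c t) (c b) ≡ true
  cycle-neighbours zero = last , suc zero , last≢1 , trans (E-sym _ _) close , cycle-edge zero (suc zero) refl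
    where
    last≢1 : ¬ last ≡ suc zero
    last≢1 e = 1+n≢0 (suc-injective (trans (sym (toℕ-fromℕ (suc (suc m)))) (cong toℕ e)))
  cycle-neighbours (suc t) with suc (toℕ (suc t)) <? suc (suc (suc m))
  ... | yes t+1< = inject₁ t , fromℕ< t+1< , t≢t+2 , cycle-edge-back t , cycle-edge (suc t) _ (toℕ-fromℕ< t+1<)
    where
    t≢t+2 : ¬ inject₁ t ≡ fromℕ< t+1<
    t≢t+2 e = n≢2+n (trans (sym (toℕ-inject₁ t)) (trans (cong toℕ e) (toℕ-fromℕ< t+1<)))
  ... | no t+1≮ = inject₁ t , zero , t≢0 , cycle-edge-back t ,
                  subst (λ x → E (c x) (c zero) ≡ true) (sym is-last) close
    where
    t≡m+1 : toℕ t ≡ suc m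
    t≡m+1 = suc-injective (≤-antisym (s≤s⁻¹ (toℕ<n (suc t))) (s≤s⁻¹ (≮⇒≥ t+1≮)))
    is-last : suc t ≡ last
    is-last = toℕ-injective (trans (cong suc t≡m+1) (sym (toℕ-fromℕ (suc (suc m)))))
    t≢0 : ¬ inject₁ t ≡ zero
    t≢0 e = 1+n≢0 (trans (sym t≡m+1) (trans (sym (toℕ-inject₁ t)) (cong toℕ e)))

-- If, for some score function, every vertex has at most one neighbour of score not
-- exceeding its own, the graph is acyclic: a vertex of maximal score on a cycle would
-- have two such neighbours there.
acyclic-by-score : ∀ {n} (E : ERel n) → (∀ u v → E u v ≡ E v u) → (score : Fin n → ℕ) →
  (∀ x y y' → E x y ≡ true → E x y' ≡ true → score y ≤ score x → score y' ≤ score x → y ≡ y') →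
  Acyclic E
acyclic-by-score E E-sym score unique-lower C with argmax (score ∘ Cycle.c C)
... | t , max with cycle-neighbours E-sym C t
... | a , b , a≢b , ea , eb = a≢b (Cycle.inj C (unique-lower _ _ _ ea eb (max a) (max b)))

leaf-degree : ∀ {n} (G : Graph n) v → notLeaf G v ≡ false → degree (adj G) v ≡ 1
leaf-degree G v nl with degree (adj G) v
leaf-degree G v nl | suc zero = refl
leaf-degree G v () | zero
leaf-degree G v () | suc (suc _)

notLeaf-false⇒isLeaf : ∀ {n} (G : Graph n) v → notLeaf G v ≡ false → isLeaf G v ≡ true
notLeaf-false⇒isLeaf G v nl with isLeaf G v
notLeaf-false⇒isLeaf G v nl | true = refl
notLeaf-false⇒isLeaf G v () | false

degree≥2⇒notLeaf : ∀ {n} (G : Graph n) v → 2 ≤ degree (adj G) v → notLeaf G v ≡ true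
degree≥2⇒notLeaf G v h with degree (adj G) v
degree≥2⇒notLeaf G v (s≤s (s≤s _)) | suc (suc _) = refl

degree1⇒leaf : ∀ {n} (G : Graph n) v → degree (adj G) v ≡ 1 → notLeaf G v ≡ false
degree1⇒leaf G v h with degree (adj G) v
degree1⇒leaf G v refl | suc zero = refl

unique-neighbour : ∀ {n} (E : ERel n) x → degree E x ≡ 1 → ∀ a b → E x a ≡ true → E x b ≡ true → a ≡ b
unique-neighbour E x deg1 a b ea eb with a ≟ᶠ b
... | yes a≡b = a≡b
... | no  a≢b with ≤-trans (count≥2 (E x) a≢b ea eb) (≤-reflexive (trans (sym (degree≡count E x)) deg1))
... | s≤s ()

adjacent-leaves-isolated : ∀ {n} (G : Graph n) → Connected allV (adj G) → ∀ u v →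
  degree (adj G) u ≡ 1 → degree (adj G) v ≡ 1 → adj G u v ≡ true → ∀ z → z ≡ u ⊎ z ≡ v
adjacent-leaves-isolated G conn u v du dv uv z = stays (conn u z refl refl) (inj₁ refl)
  where
  stays : ∀ {x y} → Walk (adj G) x y → x ≡ u ⊎ x ≡ v → y ≡ u ⊎ y ≡ v
  stays here                 at = at
  stays (step {v = y} e w) (inj₁ refl) = stays w (inj₂ (unique-neighbour (adj G) u du y v e uv))
  stays (step {v = y} e w) (inj₂ refl) =
    stays w (inj₁ (unique-neighbour (adj G) v dv y u e (trans (Graph.sym G v u) uv)))

index-or : ∀ {m} → Fin m → ℕ → Fin m
index-or {m} d t with t <? m
... | yes t<m = fromℕ< t<m
... | no  _   = d

index-or-correct : ∀ {m} (d j : Fin m) {t} → toℕ j ≡ t → index-or d t ≡ j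
index-or-correct {m} d j {t} refl with toℕ j <? m
... | yes j<m = toℕ-injective (toℕ-fromℕ< j<m)
... | no  j≮m = ⊥-elim (j≮m (toℕ<n j))

path-degree≤2 : ∀ {n} {W : VSet n} {E : ERel n} → IsPath W E → ∀ v → W v ≡ true →
  (P : Fin n → Bool) → (∀ w → P w ≡ true → W w ≡ true × E v w ≡ true) → count P ≤ 2
path-degree≤2 {n} {W} {E} (m , p , _ , _ , onto , adjacency) v Wv P neighbour with onto v Wv
... | j , refl = count≤2 P (p (index-or j (suc (toℕ j)))) (p (index-or j (toℕ j ∸ 1))) next-or-previous
  where
  next-or-previous : ∀ w → P w ≡ true → w ≡ p (index-or j (suc (toℕ j))) ⊎ w ≡ p (index-or j (toℕ j ∸ 1))
  next-or-previous w Pw with neighbour w Pw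
  ... | Ww , Evw with onto w Ww
  ... | j' , refl with proj₁ (adjacency j j') Evw
  ... | inj₁ j≡j'+1 = inj₂ (cong p (sym (index-or-correct j j' (sym (cong (_∸ 1) j≡j'+1)))))
  ... | inj₂ j'≡j+1 = inj₁ (cong p (sym (index-or-correct j j' j'≡j+1)))

induced-intro : ∀ {n} (E : ERel n) (W : VSet n) {u v} → W u ≡ true → W v ≡ true → E u v ≡ true →
  induced E W u v ≡ true
induced-intro E W Wu Wv Euv rewrite Wu | Wv = Euv

induced-elim : ∀ {n} (E : ERel n) (W : VSet n) u v → induced E W u v ≡ true → E u v ≡ true
induced-elim E W u v h with W u | W v
... | true  | true  = h
... | true  | false = ⊥-elim (false≢true h)
... | false | _     = ⊥-elim (false≢true h)

ceilDiv-≥ : ∀ a c → a ≤ ceilDiv a (suc c) * suc c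
ceilDiv-≥ a c = +-cancelˡ-≤ c a _ (begin
  c + a                                     ≡⟨ +-comm c a ⟩
  a + c                                     ≡⟨ m≡m%n+[m/n]*n (a + c) (suc c) ⟩
  (a + c) % suc c + (a + c) / suc c * suc c ≤⟨ +-monoˡ-≤ _ (s≤s⁻¹ (m%n<n (a + c) (suc c))) ⟩
  c + (a + c) / suc c * suc c               ∎)
  where open ≤-Reasoning

ceilDiv-pos : ∀ a c → 1 ≤ a → 1 ≤ ceilDiv a (suc c)
ceilDiv-pos a c 1≤a = m≥n⇒m/n>0 {a + c} {suc c} (+-monoˡ-≤ c 1≤a)

ceilDiv-≤ : ∀ a c k → a ≤ k * suc c → ceilDiv a (suc c) ≤ k
ceilDiv-≤ a c k a≤ = s≤s⁻¹ (m<n*o⇒m/o<n {a + c} {suc k} {suc c} (s≤s (begin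
  a + c             ≤⟨ +-monoˡ-≤ c a≤ ⟩
  k * suc c + c     ≡⟨ +-comm (k * suc c) c ⟩
  c + k * suc c     ∎)))
  where open ≤-Reasoning

rank : ∀ {n} → (Fin n → Bool) → Fin n → ℕ
rank S zero    = 0
rank S (suc w) = 𝟙 (S zero) + rank (S ∘ suc) w

rank<count : ∀ {n} (S : Fin n → Bool) w → S w ≡ true → rank S w < count S
rank<count S zero    Sw rewrite Sw = s≤s z≤n
rank<count S (suc w) Sw = +-monoʳ-< (𝟙 (S zero)) (rank<count (S ∘ suc) w Sw)

_∈[_,_⟩ : ℕ → ℕ → ℕ → Bool
r ∈[ a , b ⟩ = (a ≤ᵇ r) ∧ (r <ᵇ b)

∈-pred : ∀ r a b → suc r ∈[ a , b ⟩ ≡ r ∈[ pred a , pred b ⟩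
∈-pred r zero          zero    = refl
∈-pred r zero          (suc b) = refl
∈-pred r (suc zero)    zero    = refl
∈-pred r (suc zero)    (suc b) = refl
∈-pred r (suc (suc a)) zero    = refl
∈-pred r (suc (suc a)) (suc b) = refl

-- Since ranks within S are distinct, at most b ∸ a elements of S have rank in [a , b⟩.
window-count : ∀ {n} (S : Fin n → Bool) a b → count (λ w → S w ∧ rank S w ∈[ a , b ⟩) ≤ b ∸ a
window-count {zero}  S a b = z≤n
window-count {suc n} S a b with S zero
... | false = window-count (S ∘ suc) a b
... | true  = begin
  𝟙 (0 ∈[ a , b ⟩) + count (λ w → S (suc w) ∧ suc (rank (S ∘ suc) w) ∈[ a , b ⟩)
    ≡⟨ cong (𝟙 (0 ∈[ a , b ⟩) +_) (∑-cong n λ w → cong (λ x → 𝟙 (S (suc w) ∧ x)) (∈-pred _ a b)) ⟩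
  𝟙 (0 ∈[ a , b ⟩) + count (λ w → S (suc w) ∧ rank (S ∘ suc) w ∈[ pred a , pred b ⟩)
    ≤⟨ +-monoʳ-≤ _ (window-count (S ∘ suc) (pred a) (pred b)) ⟩
  𝟙 (0 ∈[ a , b ⟩) + (pred b ∸ pred a)
    ≤⟨ first-slot a b ⟩
  b ∸ a ∎
  where
  open ≤-Reasoning
  first-slot : ∀ a b → 𝟙 (0 ∈[ a , b ⟩) + (pred b ∸ pred a) ≤ b ∸ a
  first-slot zero    zero    = z≤n
  first-slot zero    (suc b) = ≤-refl
  first-slot (suc a) zero    = ≤-reflexive (0∸n≡0 a)
  first-slot (suc a) (suc b) = ≤-refl

<-next-multiple : ∀ r Q .{{_ : NonZero Q}} → suc r ≤ suc (r / Q) * Q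
<-next-multiple r Q = begin
  suc r                   ≡⟨ cong suc (m≡m%n+[m/n]*n r Q) ⟩
  suc (r % Q + r / Q * Q) ≤⟨ +-monoˡ-≤ _ (m%n<n r Q) ⟩
  Q + r / Q * Q           ∎
  where open ≤-Reasoning

∈-own-window : ∀ r Q .{{_ : NonZero Q}} → r ∈[ r / Q * Q , suc (r / Q) * Q ⟩ ≡ true
∈-own-window r Q
  rewrite Equivalence.to T-≡ (≤⇒≤ᵇ (m/n*n≤m r Q))
        | Equivalence.to T-≡ (≤⇒≤ᵇ (<-next-multiple r Q)) = refl

-- The covering of a caterpillar T of maximum degree ≤ Δ by k = ⌈(Δ-2)/(d-2)⌉ subtrees of
-- maximum degree ≤ d = c + 3.  Every subtree Hᵢ contains the whole spine; a spine vertex v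
-- with s ≤ 2 spine neighbours has room for q(v) = d - s leaves in each Hᵢ, and its leaves,
-- listed in order, are distributed in consecutive blocks of q(v): leaf number r goes to
-- H_{⌊r/q(v)⌋}.  Since v has at most Δ - s ≤ k·q(v) leaves, k subtrees suffice.
module UpperBound (c Δ : ℕ) (3≤Δ : 3 ≤ Δ) {n : ℕ} (T : Graph n) (tree : Tree T)
                  (spinePath : IsPath (notLeaf T) (induced (adj T) (notLeaf T)))
                  (maxDeg : MaxDegAtMost (adj T) Δ) where

  d k : ℕ
  d = suc (suc (suc c))
  k = ceilDiv (Δ ∸ 2) (suc c)

  A : ERel n
  A = adj T

  spine : VSet n
  spine = notLeaf T

  spineDeg : Fin n → ℕ
  spineDeg v = count (λ w → A v w ∧ spine w)

  leavesAt : Fin n → Fin n → Bool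
  leavesAt v w = A v w ∧ isLeaf T w

  quota : Fin n → ℕ
  quota v = d ∸ spineDeg v

  assigned : Fin k → Fin n → Fin n → Bool
  assigned i v w = rank (leavesAt v) w ∈[ toℕ i * quota v , suc (toℕ i) * quota v ⟩

  kept : Fin k → Fin n → Fin n → Bool
  kept i u v = spine u ∧ (spine v ∨ assigned i u v)

  edges : Fin k → ERel n
  edges i u v = A u v ∧ (kept i u v ∨ kept i v u)

  verts : Fin k → VSet n
  verts i v = spine v ∨ anyᵇ (edges i v)

  edges-sym : ∀ i u v → edges i u v ≡ edges i v u
  edges-sym i u v = cong₂ _∧_ (Graph.sym T u v) (∨-comm (kept i u v) (kept i v u))

  H : Fin k → Subgraph T
  H i = record
    { vs = verts i ; es = edges i ; es-sym = edges-sym i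
    ; es-adj = λ u v → ∧-left (A u v)
    ; es-vs  = λ u v e → ∨-right (spine u) (anyᵇ-intro (edges i u) v e) }

  spineDeg≤2 : ∀ v → spine v ≡ true → spineDeg v ≤ 2
  spineDeg≤2 v sv = path-degree≤2 spinePath v sv _
    λ w h → ∧-right (A v w) h , induced-intro A spine sv (∧-right (A v w) h) (∧-left (A v w) h)

  degree-split : ∀ v → spineDeg v + count (leavesAt v) ≡ degree A v
  degree-split v = trans (sym (∑-+ n _ _)) (trans (∑-cong n λ w → split (A v w) (isLeaf T w))
                                                  (sym (degree≡count A v)))
    where
    split : ∀ a l → 𝟙 (a ∧ (if l then false else true)) + 𝟙 (a ∧ l) ≡ 𝟙 a
    split false l     = refl
    split true  false = refl
    split true  true  = refl

  1≤k : 1 ≤ k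
  1≤k = ceilDiv-pos (Δ ∸ 2) c (∸-monoˡ-≤ 2 3≤Δ)

  leaf-capacity : ∀ s → s ≤ 2 → Δ ∸ s ≤ k * (d ∸ s)
  leaf-capacity zero _ = begin
    Δ                   ≤⟨ m≤n+m∸n Δ 2 ⟩
    2 + (Δ ∸ 2)         ≤⟨ +-mono-≤ (+-mono-≤ 1≤k 1≤k) (ceilDiv-≥ (Δ ∸ 2) c) ⟩
    k + k + k * suc c   ≡⟨ +-assoc k k _ ⟩
    k + (k + k * suc c) ≡⟨ cong (k +_) (sym (*-suc k (suc c))) ⟩
    k + k * suc (suc c) ≡⟨ sym (*-suc k (suc (suc c))) ⟩
    k * d               ∎
    where open ≤-Reasoning
  leaf-capacity (suc zero) _ = begin
    Δ ∸ 1               ≤⟨ m≤n+m∸n (Δ ∸ 1) 1 ⟩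
    1 + (Δ ∸ 1 ∸ 1)     ≡⟨ cong suc (∸-+-assoc Δ 1 1) ⟩
    1 + (Δ ∸ 2)         ≤⟨ +-mono-≤ 1≤k (ceilDiv-≥ (Δ ∸ 2) c) ⟩
    k + k * suc c       ≡⟨ sym (*-suc k (suc c)) ⟩
    k * suc (suc c)     ∎
    where open ≤-Reasoning
  leaf-capacity (suc (suc zero)) _ = ceilDiv-≥ (Δ ∸ 2) c
  leaf-capacity (suc (suc (suc s))) (s≤s (s≤s ()))

  edge-at-spine : ∀ i v w → spine v ≡ true →
    𝟙 (edges i v w) ≤ 𝟙 (A v w ∧ spine w) + 𝟙 (leavesAt v w ∧ assigned i v w)
  edge-at-spine i v w sv = bound (A v w) (isLeaf T w) (assigned i v w) (assigned i w v) sv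
    where
    bound : ∀ a l x y {s} → s ≡ true →
      𝟙 (a ∧ ((s ∧ ((if l then false else true) ∨ x)) ∨ ((if l then false else true) ∧ (s ∨ y))))
        ≤ 𝟙 (a ∧ (if l then false else true)) + 𝟙 ((a ∧ l) ∧ x)
    bound false l     x     y refl = z≤n
    bound true  false x     y refl = s≤s z≤n
    bound true  true  false y refl = z≤n
    bound true  true  true  y refl = s≤s z≤n

  -- Each Hᵢ has maximum degree at most d: a leaf keeps degree ≤ 1, and a spine vertex v
  -- keeps its spineDeg v spine neighbours plus at most quota v = d - spineDeg v leaves.
  maxDegree : ∀ i → MaxDegAtMost (edges i) d
  maxDegree i v with true-or-false (spine v)
  ... | inj₂ sv = begin
    degree (edges i) v ≡⟨ degree≡count (edges i) v ⟩
    count (edges i v)  ≤⟨ ∑-mono n (λ w → 𝟙-∧ (A v w) _) ⟩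
    count (A v)        ≡⟨ trans (sym (degree≡count A v)) (leaf-degree T v sv) ⟩
    1                  ≤⟨ s≤s z≤n ⟩
    d                  ∎
    where
    open ≤-Reasoning
    𝟙-∧ : ∀ a b → 𝟙 (a ∧ b) ≤ 𝟙 a
    𝟙-∧ false b     = z≤n
    𝟙-∧ true  false = z≤n
    𝟙-∧ true  true  = ≤-refl
  ... | inj₁ sv = begin
    degree (edges i) v
      ≡⟨ degree≡count (edges i) v ⟩
    count (edges i v)
      ≤⟨ ∑-mono n (λ w → edge-at-spine i v w sv) ⟩
    ∑ n (λ w → 𝟙 (A v w ∧ spine w) + 𝟙 (leavesAt v w ∧ assigned i v w))
      ≡⟨ ∑-+ n _ _ ⟩
    spineDeg v + count (λ w → leavesAt v w ∧ assigned i v w)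
      ≤⟨ +-monoʳ-≤ (spineDeg v) (window-count (leavesAt v) (toℕ i * quota v) (suc (toℕ i) * quota v)) ⟩
    spineDeg v + (suc (toℕ i) * quota v ∸ toℕ i * quota v)
      ≡⟨ cong (spineDeg v +_) (m+n∸n≡m (quota v) (toℕ i * quota v)) ⟩
    spineDeg v + (d ∸ spineDeg v)
      ≡⟨ m+[n∸m]≡n (≤-trans (spineDeg≤2 v sv) (s≤s (s≤s z≤n))) ⟩
    d ∎
    where open ≤-Reasoning

  leaves-fit : ∀ u → spine u ≡ true → count (leavesAt u) ≤ k * quota u
  leaves-fit u su = begin
    count (leavesAt u)         ≤⟨ m+n≤o⇒m≤o∸n _ leaves+spine≤Δ ⟩
    Δ ∸ spineDeg u             ≤⟨ leaf-capacity (spineDeg u) (spineDeg≤2 u su) ⟩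
    k * quota u                ∎
    where
    open ≤-Reasoning
    leaves+spine≤Δ : count (leavesAt u) + spineDeg u ≤ Δ
    leaves+spine≤Δ = ≤-trans (≤-reflexive (trans (+-comm _ (spineDeg u)) (degree-split u))) (maxDeg u)

  kept⇒edge : ∀ i u v → A u v ≡ true → kept i u v ≡ true → edges i u v ≡ true
  kept⇒edge i u v uv h rewrite uv | h = refl

  kept-at-spine : ∀ i u v → spine u ≡ true → spine v ∨ assigned i u v ≡ true → kept i u v ≡ true
  kept-at-spine i u v su h rewrite su = h

  spine-edge : ∀ i u v → A u v ≡ true → spine u ≡ true → spine v ≡ true → edges i u v ≡ true
  spine-edge i u v uv su sv = kept⇒edge i u v uv (kept-at-spine i u v su (∨-left (assigned i u v) sv))

  -- An edge from a spine vertex u to a leaf v lies in the subtree v is assigned to,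
  -- namely the ⌊r / quota u⌋-th where r is the rank of v among the leaves of u.
  cover-leaf-edge : ∀ u v → spine u ≡ true → spine v ≡ false → A u v ≡ true → ∃ λ i → edges i u v ≡ true
  cover-leaf-edge u v su sv uv =
    i , kept⇒edge i u v uv (kept-at-spine i u v su (∨-right (spine v) v-assigned))
    where
    Q : ℕ
    Q = quota u
    instance
      Q≢0 : NonZero Q
      Q≢0 = >-nonZero (m<n⇒0<n∸m (s≤s (≤-trans (spineDeg≤2 u su) (s≤s (s≤s z≤n)))))
    r : ℕ
    r = rank (leavesAt u) v
    r<kQ : r < k * Q
    r<kQ = <-≤-trans (rank<count (leavesAt u) v v-leaf) (leaves-fit u su)
      where
      v-leaf : leavesAt u v ≡ true
      v-leaf rewrite uv | notLeaf-false⇒isLeaf T v sv = refl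
    r/Q<k : r / Q < k
    r/Q<k = m<n*o⇒m/o<n {r} {k} {Q} r<kQ
    i : Fin k
    i = fromℕ< r/Q<k
    v-assigned : assigned i u v ≡ true
    v-assigned = subst (λ t → r ∈[ t * Q , suc t * Q ⟩ ≡ true) (sym (toℕ-fromℕ< r/Q<k)) (∈-own-window r Q)

  -- From now on T has a spine vertex z (otherwise T is a single edge).
  module _ (z : Fin n) (sz : spine z ≡ true) where

    -- Every edge of T lies in some Hᵢ.  An edge between two leaves is impossible, as then
    -- these two leaves would be the whole tree, leaving no room for z.
    covers : Covers T H
    covers u v uv with true-or-false (spine u) | true-or-false (spine v)
    ... | inj₁ su | inj₁ sv = fromℕ< 1≤k , spine-edge (fromℕ< 1≤k) u v uv su sv
    ... | inj₁ su | inj₂ sv = cover-leaf-edge u v su sv uv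
    ... | inj₂ su | inj₁ sv with cover-leaf-edge v u sv su (trans (Graph.sym T v u) uv)
    ...   | i , vu = i , trans (edges-sym i u v) vu
    covers u v uv | inj₂ su | inj₂ sv
      with adjacent-leaves-isolated T (proj₁ (proj₂ tree)) u v
             (leaf-degree T u su) (leaf-degree T v sv) uv z
    ... | inj₁ refl = ⊥-elim (false≢true (trans (sym su) sz))
    ... | inj₂ refl = ⊥-elim (false≢true (trans (sym sv) sz))

    -- Each Hᵢ is a tree: it contains the spine path, every other vertex of Hᵢ is joined to
    -- the spine by an edge of Hᵢ, and it is acyclic as a subgraph of T.
    isTree : ∀ i → IsTree (verts i) (edges i)
    isTree i = (z , ∨-left _ sz) , connected spinePath , acyclic-sub (λ u v → ∧-left (A u v)) (proj₂ (proj₂ tree))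
      where
      leaf-edge-to-spine : ∀ u w → spine u ≡ false → edges i u w ≡ true → spine w ≡ true
      leaf-edge-to-spine u w su h = reach (A u w) (spine u) (spine w) su h
        where
        reach : ∀ a s s' {X Y} → s ≡ false → a ∧ ((s ∧ X) ∨ (s' ∧ Y)) ≡ true → s' ≡ true
        reach true false true refl _ = refl

      connected : IsPath spine (induced A spine) → Connected (verts i) (edges i)
      connected (m , p , _ , on-spine , onto , adjacency) u v hu hv =
        let (a , ua) = to-spine u hu
            (b , vb) = to-spine v hv
        in ua ++ʷ (pathWalk (edges i) (edges-sym i) p along-spine a b ++ʷ reverseʷ (edges-sym i) vb)
        where
        to-spine : ∀ u → verts i u ≡ true → Σ (Fin m) λ j → Walk (edges i) u (p j)
        to-spine u h with true-or-false (spine u)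
        ... | inj₁ su with onto u su
        ...   | j , refl = j , here
        to-spine u h | inj₂ su with anyᵇ-elim (edges i u) (subst (λ b → b ∨ anyᵇ (edges i u) ≡ true) su h)
        ... | w , uw with onto w (leaf-edge-to-spine u w su uw)
        ...   | j , refl = j , step uw here

        along-spine : Consecutive (edges i) p
        along-spine a b b≡a+1 = spine-edge i (p a) (p b)
          (induced-elim A spine _ _ (proj₂ (adjacency a b) (inj₂ b≡a+1))) (on-spine a) (on-spine b)

  -- The covering.  If T has no spine vertex, all its vertices are leaves (T is a single
  -- edge) and k copies of T itself will do.
  covering : Σ (Fin k → Subgraph T) λ H → (∀ i → IsSubtreeMaxDeg d (H i)) × Covers T H
  covering with exists? spine
  ... | yes (z , sz) = H , (λ i → isTree z sz i , maxDegree i) , covers z sz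
  ... | no  no-spine = (λ _ → whole) , (λ _ → tree , degree≤1) , (λ u v uv → fromℕ< 1≤k , uv)
    where
    whole : Subgraph T
    whole = record { vs = allV ; es = A ; es-sym = Graph.sym T ; es-adj = λ _ _ uv → uv ; es-vs = λ _ _ _ → refl }
    degree≤1 : MaxDegAtMost A d
    degree≤1 v with true-or-false (spine v)
    ... | inj₁ sv = ⊥-elim (no-spine (v , sv))
    ... | inj₂ sv = ≤-trans (≤-reflexive (leaf-degree T v sv)) (s≤s z≤n)

upper-bound : ∀ (Δ d : ℕ) → 3 ≤ d → d ≤ Δ →
  ∀ {n} (T : Graph n) → Caterpillar T → MaxDegAtMost (adj T) Δ →
  Σ (Fin (ceilDiv (Δ ∸ 2) (d ∸ 2)) → Subgraph T) λ H → (∀ i → IsSubtreeMaxDeg d (H i)) × Covers T H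
upper-bound Δ (suc (suc (suc c))) (s≤s (s≤s (s≤s _))) d≤Δ T (tree , spinePath) maxDeg =
  UpperBound.covering c Δ (≤-trans (s≤s (s≤s (s≤s z≤n))) d≤Δ) T tree spinePath maxDeg

-- The extremal caterpillar: a spine of M = M' + 2 vertices sp 0, …, sp (M-1), each carrying
-- L = e + 1 leaves lf b 0, …, lf b (L-1).  Vertex (b , r) of Fin M × Fin (L + 1) is encoded
-- as combine b r, with r = 0 for the spine vertex and r = t + 1 for the leaf lf b t.
module Extremal (M' e : ℕ) where

  M L B n : ℕ
  M = suc (suc M')
  L = suc e
  B = suc L
  n = M * B

  from : Fin M × Fin B → Fin M × Fin B → Bool
  from (b , zero)  (b' , zero)  = toℕ b' ≡ᵇ suc (toℕ b)
  from (b , zero)  (b' , suc _) = toℕ b ≡ᵇ toℕ b'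
  from (b , suc _) _            = false

  adjacent : Fin M × Fin B → Fin M × Fin B → Bool
  adjacent P Q = from P Q ∨ from Q P

  A : ERel n
  A x y = adjacent (remQuot B x) (remQuot B y)

  T : Graph n
  T = record
    { adj    = A
    ; sym    = λ x y → ∨-comm (from (remQuot B x) (remQuot B y)) (from (remQuot B y) (remQuot B x))
    ; irrefl = λ x → irreflexive (remQuot B x) }
    where
    irreflexive : ∀ P → adjacent P P ≡ false
    irreflexive (b , zero)  rewrite ≢ᵇ-suc (toℕ b) = refl
    irreflexive (b , suc _) = refl

  sp : Fin M → Fin n
  sp b = combine {M} {B} b zero

  lf : Fin M → Fin L → Fin n
  lf b t = combine {M} {B} b (suc t)

  data View : Fin n → Set where
    spine : ∀ b → View (sp b)
    leaf  : ∀ b t → View (lf b t)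

  view : ∀ x → View x
  view x = subst View (combine-remQuot {M} B x) (classify (remQuot B x))
    where
    classify : ∀ P → View (uncurry combine P)
    classify (b , zero)  = spine b
    classify (b , suc t) = leaf b t

  A-combine : ∀ b r b' r' → A (combine b r) (combine b' r') ≡ adjacent (b , r) (b' , r')
  A-combine b r b' r' = cong₂ adjacent (remQuot-combine b r) (remQuot-combine b' r')

  A-spine : ∀ b b' → A (sp b) (sp b') ≡ true → toℕ b' ≡ suc (toℕ b) ⊎ toℕ b ≡ suc (toℕ b')
  A-spine b b' h with ∨-cases _ (trans (sym (A-combine b zero b' zero)) h)
  ... | inj₁ b'≡b+1 = inj₁ (≡ᵇ-sound _ _ b'≡b+1)
  ... | inj₂ b≡b'+1 = inj₂ (≡ᵇ-sound _ _ b≡b'+1)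

  A-spine⁻ : ∀ b b' → toℕ b' ≡ suc (toℕ b) ⊎ toℕ b ≡ suc (toℕ b') → A (sp b) (sp b') ≡ true
  A-spine⁻ b b' (inj₁ b'≡b+1) = trans (A-combine b zero b' zero) (∨-left _ (≡ᵇ-complete b'≡b+1))
  A-spine⁻ b b' (inj₂ b≡b'+1) = trans (A-combine b zero b' zero) (∨-right _ (≡ᵇ-complete b≡b'+1))

  A-spine-leaf : ∀ b b' t → A (sp b) (lf b' t) ≡ true → b ≡ b'
  A-spine-leaf b b' t h =
    toℕ-injective (≡ᵇ-sound _ _ (trans (sym (∨-identityʳ _)) (trans (sym (A-combine b zero b' (suc t))) h)))

  A-leaf-spine : ∀ b t b' → A (lf b t) (sp b') ≡ true → b' ≡ b
  A-leaf-spine b t b' h = A-spine-leaf b' b t (trans (Graph.sym T (sp b') (lf b t)) h)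

  A-own-leaf : ∀ b t → A (lf b t) (sp b) ≡ true
  A-own-leaf b t = trans (A-combine b (suc t) b zero) (∨-right false (≡ᵇ-complete {toℕ b} refl))

  A-leaf-leaf : ∀ b t b' t' → ¬ A (lf b t) (lf b' t') ≡ true
  A-leaf-leaf b t b' t' h = false≢true (trans (sym (A-combine b (suc t) b' (suc t'))) h)

  sp-injective : Injective _≡_ _≡_ sp
  sp-injective {a} {b} = combine-injectiveˡ a zero b zero

  lf-injective : ∀ b → Injective _≡_ _≡_ (lf b)
  lf-injective b {t} {t'} e = Fin-suc-injective (combine-injectiveʳ b (suc t) b (suc t') e)

  lf≢sp : ∀ b t b' → ¬ lf b t ≡ sp b'
  lf≢sp b t b' e with combine-injectiveʳ b (suc t) b' zero e
  ... | ()

  two-spines-and-leaves : ∀ b₁ b₂ j → ¬ b₁ ≡ b₂ → Injective _≡_ _≡_ (sp b₁ ∷ sp b₂ ∷ lf j)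
  two-spines-and-leaves b₁ b₂ j b₁≢b₂ = injective
    where
    injective : Injective _≡_ _≡_ (sp b₁ ∷ sp b₂ ∷ lf j)
    injective {zero}        {zero}         _ = refl
    injective {zero}        {suc zero}     e = ⊥-elim (b₁≢b₂ (sp-injective e))
    injective {zero}        {suc (suc t)}  e = ⊥-elim (lf≢sp j t b₁ (sym e))
    injective {suc zero}    {zero}         e = ⊥-elim (b₁≢b₂ (sp-injective (sym e)))
    injective {suc zero}    {suc zero}     _ = refl
    injective {suc zero}    {suc (suc t)}  e = ⊥-elim (lf≢sp j t b₂ (sym e))
    injective {suc (suc t)} {zero}         e = ⊥-elim (lf≢sp j t b₁ e)
    injective {suc (suc t)} {suc zero}     e = ⊥-elim (lf≢sp j t b₂ e)
    injective {suc (suc t)} {suc (suc t')} e = cong (λ x → suc (suc x)) (lf-injective j e)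

  spine-degree≤ : ∀ b → degree A (sp b) ≤ 2 + L
  spine-degree≤ b = subst (_≤ 2 + L) (sym (degree≡count A (sp b))) (count-image (A (sp b)) candidates listed)
    where
    candidates : Fin (2 + L) → Fin n
    candidates = sp (index-or b (suc (toℕ b))) ∷ sp (index-or b (toℕ b ∸ 1)) ∷ lf b
    listed : ∀ w → A (sp b) w ≡ true → ∃ λ t → candidates t ≡ w
    listed w h with view w
    listed _ h | spine b' with A-spine b b' h
    ... | inj₁ b'≡b+1 = zero , cong sp (index-or-correct b b' b'≡b+1)
    ... | inj₂ b≡b'+1 = suc zero , cong sp (index-or-correct b b' (sym (cong (_∸ 1) b≡b'+1)))
    listed _ h | leaf b' t with A-spine-leaf b b' t h
    ... | refl = suc (suc t) , refl

  -- Every spine vertex has a spine neighbour (M ≥ 2) and a leaf, so degree ≥ 2.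
  spine-neighbour : ∀ b → Σ (Fin M) λ b' → A (sp b) (sp b') ≡ true
  spine-neighbour b with suc (toℕ b) <? M
  ... | yes b+1<M = fromℕ< b+1<M , A-spine⁻ b _ (inj₁ (toℕ-fromℕ< b+1<M))
  ... | no  b+1≮M = fromℕ< M'<M , A-spine⁻ b _ (inj₂ (trans b≡M'+1 (cong suc (sym (toℕ-fromℕ< M'<M)))))
    where
    M'<M : M' < M
    M'<M = s≤s (n≤1+n M')
    b≡M'+1 : toℕ b ≡ suc M'
    b≡M'+1 = suc-injective (≤-antisym (toℕ<n b) (≮⇒≥ b+1≮M))

  spine-degree≥2 : ∀ b → 2 ≤ degree A (sp b)
  spine-degree≥2 b with spine-neighbour b
  ... | b' , bb' = subst (2 ≤_) (sym (degree≡count A (sp b)))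
    (count≥2 (A (sp b)) (λ e → lf≢sp b zero b' e) (trans (Graph.sym T (sp b) (lf b zero)) (A-own-leaf b zero)) bb')

  leaf-degree≡1 : ∀ b t → degree A (lf b t) ≡ 1
  leaf-degree≡1 b t = trans (degree≡count A (lf b t))
    (≤-antisym (count-image (A (lf b t)) (λ _ → sp b) only-sp)
               (count-injective (A (lf b t)) (λ _ → sp b) (λ { {zero} {zero} _ → refl }) (λ _ → A-own-leaf b t)))
    where
    only-sp : ∀ w → A (lf b t) w ≡ true → ∃ λ (_ : Fin 1) → sp b ≡ w
    only-sp w h with view w
    only-sp _ h | spine b'    = zero , cong sp (sym (A-leaf-spine b t b' h))
    only-sp _ h | leaf b' t'  = ⊥-elim (A-leaf-leaf b t b' t' h)

  sp-spine : ∀ b → notLeaf T (sp b) ≡ true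
  sp-spine b = degree≥2⇒notLeaf T (sp b) (spine-degree≥2 b)

  lf-leaf : ∀ b t → notLeaf T (lf b t) ≡ false
  lf-leaf b t = degree1⇒leaf T (lf b t) (leaf-degree≡1 b t)

  maxDegree : MaxDegAtMost A (2 + L)
  maxDegree x with view x
  ... | spine b  = spine-degree≤ b
  ... | leaf b t = ≤-trans (≤-reflexive (leaf-degree≡1 b t)) (s≤s z≤n)

  connected : Connected allV A
  connected x y _ _ =
    let (a , xa) = to-spine x
        (b , yb) = to-spine y
    in xa ++ʷ (pathWalk A (Graph.sym T) sp (λ a b e → A-spine⁻ a b (inj₁ e)) a b ++ʷ reverseʷ (Graph.sym T) yb)
    where
    to-spine : ∀ x → Σ (Fin M) λ b → Walk A x (sp b)
    to-spine x with view x
    ... | spine b  = b , here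
    ... | leaf b t = b , step (A-own-leaf b t) here

  -- T is acyclic: with score 2b for sp b and 2b+1 for its leaves, every vertex has at most
  -- one neighbour of smaller or equal score (sp (b-1) for sp b, and sp b for its leaves).
  position-score : Fin M × Fin B → ℕ
  position-score (b , zero)  = 2 * toℕ b
  position-score (b , suc _) = suc (2 * toℕ b)

  score : Fin n → ℕ
  score x = position-score (remQuot B x)

  score-sp : ∀ b → score (sp b) ≡ 2 * toℕ b
  score-sp b = cong position-score (remQuot-combine b zero)

  score-lf : ∀ b t → score (lf b t) ≡ suc (2 * toℕ b)
  score-lf b t = cong position-score (remQuot-combine b (suc t))

  lower-neighbour : ∀ b y → A (sp b) y ≡ true → score y ≤ score (sp b) →
    Σ (Fin M) λ b' → y ≡ sp b' × toℕ b ≡ suc (toℕ b')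
  lower-neighbour b y h le with view y
  ... | leaf b' t with A-spine-leaf b b' t h
  ...   | refl = ⊥-elim (1+n≰n (subst₂ _≤_ (score-lf b t) (score-sp b) le))
  lower-neighbour b y h le | spine b' with A-spine b b' h
  ... | inj₂ b≡b'+1 = b' , refl , b≡b'+1
  ... | inj₁ b'≡b+1 =
    ⊥-elim (<⇒≱ (*-monoʳ-< 2 (≤-reflexive (sym b'≡b+1))) (subst₂ _≤_ (score-sp b') (score-sp b) le))

  unique-lower-neighbour : ∀ x y y' → A x y ≡ true → A x y' ≡ true →
    score y ≤ score x → score y' ≤ score x → y ≡ y'
  unique-lower-neighbour x y y' h h' le le' with view x
  ... | spine b with lower-neighbour b y h le | lower-neighbour b y' h' le'
  ...   | b₁ , refl , b≡b₁+1 | b₂ , refl , b≡b₂+1 =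
    cong sp (toℕ-injective (suc-injective (trans (sym b≡b₁+1) b≡b₂+1)))
  unique-lower-neighbour x y y' h h' le le' | leaf b t = trans (only-sp y h) (sym (only-sp y' h'))
    where
    only-sp : ∀ z → A (lf b t) z ≡ true → z ≡ sp b
    only-sp z hz with view z
    ... | spine b'   = cong sp (A-leaf-spine b t b' hz)
    ... | leaf b' t' = ⊥-elim (A-leaf-leaf b t b' t' hz)

  tree : Tree T
  tree = (sp zero , refl) , connected , acyclic-by-score A (Graph.sym T) score unique-lower-neighbour

  spine-path : IsPath (notLeaf T) (induced A (notLeaf T))
  spine-path = M , sp , sp-injective , sp-spine , onto , adjacency
    where
    onto : ∀ v → notLeaf T v ≡ true → ∃ λ i → sp i ≡ v
    onto v h with view v
    ... | spine b  = b , refl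
    ... | leaf b t = ⊥-elim (false≢true (trans (sym (lf-leaf b t)) h))
    swap : ∀ {P Q : Set} → P ⊎ Q → Q ⊎ P
    swap (inj₁ p) = inj₂ p
    swap (inj₂ q) = inj₁ q
    adjacency : ∀ i j → (induced A (notLeaf T) (sp i) (sp j) ≡ true → (toℕ i ≡ suc (toℕ j) ⊎ toℕ j ≡ suc (toℕ i)))
                      × ((toℕ i ≡ suc (toℕ j) ⊎ toℕ j ≡ suc (toℕ i)) → induced A (notLeaf T) (sp i) (sp j) ≡ true)
    adjacency i j = (λ h → swap (A-spine i j (induced-elim A (notLeaf T) (sp i) (sp j) h)))
                  , (λ h → induced-intro A (notLeaf T) {sp i} {sp j} (sp-spine i) (sp-spine j)
                                         (A-spine⁻ i j (swap h)))

  caterpillar : Caterpillar T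
  caterpillar = tree , spine-path

-- The lower bound: in a covering of the extremal caterpillar by k subtrees of maximum degree
-- ≤ d = c + 3, where 2k < M, some spine vertex sp j lies in no subtree "at an end", i.e.
-- every subtree through sp j contains both spine edges at sp j (each subtree meets the spine
-- in a path, which has only two ends).  Such a subtree contains at most d - 2 = c + 1 of
-- the L leaves of sp j, hence L ≤ k·(c + 1).
module LowerBound (M' e c k : ℕ) where
  open Extremal M' e

  d : ℕ
  d = suc (suc (suc c))

  block : Fin n → ℕ
  block x = toℕ (proj₁ (remQuot {M} B x))

  block-sp : ∀ b → block (sp b) ≡ toℕ b
  block-sp b = cong (toℕ ∘ proj₁) (remQuot-combine b zero)

  block-lf : ∀ b t → block (lf b t) ≡ toℕ b
  block-lf b t = cong (toℕ ∘ proj₁) (remQuot-combine b (suc t))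

  cross-edge : ∀ x y → A x y ≡ true → block y < block x →
    Σ (Fin M) λ b → Σ (Fin M) λ b' → x ≡ sp b × y ≡ sp b' × toℕ b ≡ suc (toℕ b')
  cross-edge x y h lt with view x | view y
  ... | spine b | spine b' with A-spine b b' h
  ...   | inj₂ b≡b'+1 = b , b' , refl , refl , b≡b'+1
  ...   | inj₁ b'≡b+1 = ⊥-elim (<-asym (subst₂ _<_ (block-sp b') (block-sp b) lt) (≤-reflexive (sym b'≡b+1)))
  cross-edge x y h lt | spine b | leaf b' t with A-spine-leaf b b' t h
  ...   | refl = ⊥-elim (<-irrefl (trans (block-lf b t) (sym (block-sp b))) lt)
  cross-edge x y h lt | leaf b t | spine b' with A-leaf-spine b t b' h
  ...   | refl = ⊥-elim (<-irrefl (trans (block-sp b) (sym (block-lf b t))) lt)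
  cross-edge x y h lt | leaf b t | leaf b' t' = ⊥-elim (A-leaf-leaf b t b' t' h)

  module _ (H : Fin k → Subgraph T) (subtrees : ∀ i → IsSubtreeMaxDeg d (H i)) (covers : Covers T H) where

    E : Fin k → ERel n
    E i = es (H i)

    W : Fin k → VSet n
    W i = vs (H i)

    spineEdge : Fin k → Fin M → Fin M → Bool
    spineEdge i b b' = (toℕ b ≡ᵇ suc (toℕ b')) ∧ E i (sp b) (sp b')

    crossing : ∀ i t {x y} → Walk (E i) x y → t ≤ block x → block y < t →
      Σ (Fin M) λ b → Σ (Fin M) λ b' → toℕ b ≡ t × spineEdge i b b' ≡ true
    crossing i t here t≤x y<t = ⊥-elim (<-irrefl refl (<-≤-trans y<t t≤x))
    crossing i t {x} (step {v = z} xz walk) t≤x y<t with t ≤? block z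
    ... | yes t≤z = crossing i t walk t≤z y<t
    ... | no  t≰z with cross-edge x z (es-adj (H i) x z xz) (<-≤-trans (≰⇒> t≰z) t≤x)
    ...   | b , b' , refl , refl , b≡b'+1 =
      b , b' , b≡t , subst (λ β → β ∧ E i (sp b) (sp b') ≡ true) (sym (≡ᵇ-complete b≡b'+1)) xz
      where
      b≡t : toℕ b ≡ t
      b≡t = ≤-antisym (subst (_≤ t) (trans (cong suc (block-sp b')) (sym b≡b'+1)) (≰⇒> t≰z))
                      (subst (t ≤_) (block-sp b) t≤x)

    H-connected : ∀ i → Connected (W i) (E i)
    H-connected i = proj₁ (proj₂ (proj₁ (subtrees i)))

    hasLeft hasRight : Fin k → Fin M → Bool
    hasLeft  i j = anyᵇ (spineEdge i j)
    hasRight i j = anyᵇ (λ b → spineEdge i b j)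

    leftEnd rightEnd : Fin k → Fin M → Bool
    leftEnd  i j = W i (sp j) ∧ not (hasLeft i j)
    rightEnd i j = W i (sp j) ∧ not (hasRight i j)

    -- Hᵢ has at most one left end: a walk in Hᵢ from a left end sp a down to a left end
    -- sp b with b < a would use the missing spine edge at sp a.
    leftEnd-unique : ∀ i a b → leftEnd i a ≡ true → leftEnd i b ≡ true → a ≡ b
    leftEnd-unique i a b ea eb = toℕ-injective (≤-antisym (below a b ea eb) (below b a eb ea))
      where
      below : ∀ a b → leftEnd i a ≡ true → leftEnd i b ≡ true → toℕ a ≤ toℕ b
      below a b ea eb
        with toℕ a ≤? toℕ b | ∧-not (W i (sp a)) (hasLeft i a) ea | ∧-not (W i (sp b)) (hasLeft i b) eb
      ... | yes a≤b | _ | _ = a≤b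
      ... | no  a≰b | Wa , no-left | Wb , _
        with crossing i (toℕ a) (H-connected i (sp a) (sp b) Wa Wb) (≤-reflexive (sym (block-sp a)))
                                (subst (_< toℕ a) (sym (block-sp b)) (≰⇒> a≰b))
      ... | a' , b' , a'≡a , edge with toℕ-injective a'≡a
      ...   | refl = ⊥-elim (false≢true (trans (sym no-left) (anyᵇ-intro (spineEdge i a') b' edge)))

    rightEnd-unique : ∀ i a b → rightEnd i a ≡ true → rightEnd i b ≡ true → a ≡ b
    rightEnd-unique i a b ea eb = toℕ-injective (≤-antisym (below b a eb ea) (below a b ea eb))
      where
      below : ∀ a b → rightEnd i a ≡ true → rightEnd i b ≡ true → toℕ b ≤ toℕ a
      below a b ea eb
        with toℕ b ≤? toℕ a | ∧-not (W i (sp a)) (hasRight i a) ea | ∧-not (W i (sp b)) (hasRight i b) eb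
      ... | yes b≤a | _ | _ = b≤a
      ... | no  b≰a | Wa , no-right | Wb , _
        with crossing i (suc (toℕ a)) (H-connected i (sp b) (sp a) Wb Wa)
                        (subst (suc (toℕ a) ≤_) (sym (block-sp b)) (≰⇒> b≰a))
                        (≤-reflexive (cong suc (block-sp a)))
      ... | a' , b' , a'≡a+1 , edge
        with toℕ-injective (suc-injective (trans (sym a'≡a+1) (≡ᵇ-sound _ _ (∧-left _ edge))))
      ...   | refl = ⊥-elim (false≢true (trans (sym no-right) (anyᵇ-intro (λ b → spineEdge i b a) a' edge)))

    isEnd : Fin M → Bool
    isEnd j = anyᵇ (λ i → leftEnd i j ∨ rightEnd i j)

    ends≤2k : count isEnd ≤ k * 2
    ends≤2k = begin
      count isEnd
        ≤⟨ ∑-mono M (λ j → ≤-trans (𝟙-anyᵇ (λ i → leftEnd i j ∨ rightEnd i j))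
                                    (∑-mono k λ i → 𝟙-∨ (leftEnd i j) (rightEnd i j))) ⟩
      ∑ M (λ j → ∑ k (λ i → 𝟙 (leftEnd i j) + 𝟙 (rightEnd i j)))
        ≡⟨ ∑-swap M k (λ j i → 𝟙 (leftEnd i j) + 𝟙 (rightEnd i j)) ⟩
      ∑ k (λ i → ∑ M (λ j → 𝟙 (leftEnd i j) + 𝟙 (rightEnd i j)))
        ≤⟨ ∑-bound k 2 two-ends ⟩
      k * 2 ∎
      where
      open ≤-Reasoning
      two-ends : ∀ i → ∑ M (λ j → 𝟙 (leftEnd i j) + 𝟙 (rightEnd i j)) ≤ 2
      two-ends i = ≤-trans (≤-reflexive (∑-+ M (𝟙 ∘ leftEnd i) (𝟙 ∘ rightEnd i)))
        (+-mono-≤ (count≤1 (leftEnd i) (leftEnd-unique i)) (count≤1 (rightEnd i) (rightEnd-unique i)))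
      𝟙-∨ : ∀ a b → 𝟙 (a ∨ b) ≤ 𝟙 a + 𝟙 b
      𝟙-∨ true  b = s≤s z≤n
      𝟙-∨ false b = ≤-refl

    inner-vertex : 2 * k < M → Σ (Fin M) λ j → isEnd j ≡ false
    inner-vertex 2k<M with exists? (not ∘ isEnd)
    ... | yes (j , not-end) = j , not-true (isEnd j) not-end
      where
      not-true : ∀ b → not b ≡ true → b ≡ false
      not-true false _ = refl
    ... | no  all-ends = ⊥-elim (<⇒≱ 2k<M (begin
      M             ≤⟨ count-injective isEnd id id is-end ⟩
      count isEnd   ≤⟨ ends≤2k ⟩
      k * 2         ≡⟨ *-comm k 2 ⟩
      2 * k         ∎))
      where
      open ≤-Reasoning
      is-end : ∀ j → isEnd j ≡ true
      is-end j with true-or-false (isEnd j)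
      ... | inj₁ end   = end
      ... | inj₂ inner = ⊥-elim (all-ends (j , cong not inner))

    module _ (j : Fin M) (inner : isEnd j ≡ false) where

      leafEdges : Fin k → ℕ
      leafEdges i = count (λ t → E i (sp j) (lf j t))

      both-spine-edges : ∀ i → W i (sp j) ≡ true → hasLeft i j ≡ true × hasRight i j ≡ true
      both-spine-edges i Wj with true-or-false (leftEnd i j ∨ rightEnd i j)
      ... | inj₁ end =
        ⊥-elim (false≢true (trans (sym inner) (anyᵇ-intro (λ i → leftEnd i j ∨ rightEnd i j) i end)))
      ... | inj₂ not-end with ∨-false (leftEnd i j) (rightEnd i j) not-end
      ...   | not-left , not-right =
        ∧-not-false (hasLeft i j) Wj not-left , ∧-not-false (hasRight i j) Wj not-right

      leafEdges+2≤d : ∀ i → W i (sp j) ≡ true → 2 + leafEdges i ≤ d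
      leafEdges+2≤d i present with both-spine-edges i present
      ... | left , right with anyᵇ-elim (spineEdge i j) left | anyᵇ-elim (λ b → spineEdge i b j) right
      ... | b₁ , e₁ | b₂ , e₂ = begin
        2 + leafEdges i
          ≡⟨ cong₂ (λ x y → 𝟙 x + (𝟙 y + leafEdges i)) (sym (∧-right (toℕ j ≡ᵇ suc (toℕ b₁)) e₁))
                   (sym (trans (es-sym (H i) (sp j) (sp b₂)) (∧-right (toℕ b₂ ≡ᵇ suc (toℕ j)) e₂))) ⟩
        count (E i (sp j) ∘ (sp b₁ ∷ sp b₂ ∷ lf j))
          ≤⟨ count-∘-injective (E i (sp j)) _ (two-spines-and-leaves b₁ b₂ j b₁≢b₂) ⟩
        count (E i (sp j))
          ≡⟨ sym (degree≡count (E i) (sp j)) ⟩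
        degree (E i) (sp j)
          ≤⟨ proj₂ (subtrees i) (sp j) ⟩
        d ∎
        where
        open ≤-Reasoning
        b₁≢b₂ : ¬ b₁ ≡ b₂
        b₁≢b₂ refl = n≢2+n (trans (≡ᵇ-sound (toℕ j) _ (∧-left (toℕ j ≡ᵇ suc (toℕ b₁)) e₁))
                                  (cong suc (≡ᵇ-sound (toℕ b₁) _ (∧-left (toℕ b₁ ≡ᵇ suc (toℕ j)) e₂))))

      leafEdges≤ : ∀ i → leafEdges i ≤ suc c
      leafEdges≤ i with true-or-false (W i (sp j))
      ... | inj₁ present = +-cancelˡ-≤ 2 _ _ (leafEdges+2≤d i present)
      ... | inj₂ absent  = ≤-trans (count-image (λ t → E i (sp j) (lf j t)) (λ ()) λ t h → ⊥-elim (no-edge t h)) z≤n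
        where
        no-edge : ∀ t → ¬ E i (sp j) (lf j t) ≡ true
        no-edge t h = false≢true (trans (sym absent) (es-vs (H i) _ _ h))

      leaves≤ : L ≤ k * suc c
      leaves≤ = begin
        L                                                    ≡⟨ sym (∑-ones L) ⟩
        ∑ L (λ _ → 1)                                        ≤⟨ ∑-mono L covered ⟩
        ∑ L (λ t → ∑ k (λ i → 𝟙 (E i (sp j) (lf j t))))      ≡⟨ ∑-swap L k (λ t i → 𝟙 (E i (sp j) (lf j t))) ⟩
        ∑ k leafEdges                                        ≤⟨ ∑-bound k (suc c) leafEdges≤ ⟩
        k * suc c                                            ∎
        where
        open ≤-Reasoning
        covered : ∀ t → 1 ≤ ∑ k (λ i → 𝟙 (E i (sp j) (lf j t)))
        covered t with covers (sp j) (lf j t) (trans (Graph.sym T (sp j) (lf j t)) (A-own-leaf j t))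
        ... | i , e = subst (λ x → 𝟙 x ≤ ∑ k (λ i → 𝟙 (E i (sp j) (lf j t)))) e
                            (∑-term k (λ i → 𝟙 (E i (sp j) (lf j t))) i)

    bound : 2 * k < M → ceilDiv L (suc c) ≤ k
    bound 2k<M with inner-vertex 2k<M
    ... | j , inner = ceilDiv-≤ L c k (leaves≤ j inner)

-- Second half of the theorem: for every N the extremal caterpillar with M = 2K + N + 2
-- spine vertices and Δ - 2 leaves per spine vertex, K = ⌈(Δ-2)/(d-2)⌉, has at least N
-- vertices and needs K subtrees (a covering by k < K subtrees would have 2k < M).
lower-bound : ∀ (Δ d : ℕ) → 3 ≤ d → d ≤ Δ →
  ∀ (N : ℕ) → Σ ℕ λ n → N ≤ n × Σ (Graph n) λ T →
    Caterpillar T × MaxDegAtMost (adj T) Δ ×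
    (∀ k (H : Fin k → Subgraph T) → (∀ i → IsSubtreeMaxDeg d (H i)) → Covers T H →
      ceilDiv (Δ ∸ 2) (d ∸ 2) ≤ k)
lower-bound _ (suc (suc (suc c))) (s≤s (s≤s (s≤s _))) (s≤s (s≤s (s≤s {n = e} _))) N =
  n , N≤n , T , caterpillar , maxDegree , needs-K
  where
  K : ℕ
  K = ceilDiv (suc e) (suc c)
  open Extremal (2 * K + N) e

  N≤n : N ≤ n
  N≤n = ≤-trans (m≤n+m N (2 * K)) (≤-trans (≤-trans (n≤1+n _) (n≤1+n _)) (m≤m*n M B))

  needs-K : ∀ k (H : Fin k → Subgraph T) → (∀ i → IsSubtreeMaxDeg (suc (suc (suc c))) (H i)) →
    Covers T H → K ≤ k
  needs-K k H subtrees covers with K ≤? k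
  ... | yes K≤k = K≤k
  ... | no  K≰k = LowerBound.bound (2 * K + N) e c k H subtrees covers
    (≤-trans (*-monoʳ-< 2 (≰⇒> K≰k)) (≤-trans (m≤m+n (2 * K) N) (≤-trans (n≤1+n _) (n≤1+n _))))

mainTheorem15 : (∀ (Δ d : ℕ) → 3 ≤ d → d ≤ Δ →
    ∀ {n} (T : Graph n) → Caterpillar T → MaxDegAtMost (adj T) Δ →
    Σ (Fin (ceilDiv (Δ ∸ 2) (d ∸ 2)) → Subgraph T) λ H →
    (∀ i → IsSubtreeMaxDeg d (H i)) × Covers T H)
    ×
    (∀ (Δ d : ℕ) → 3 ≤ d → d ≤ Δ →
    ∀ (N : ℕ) → Σ ℕ λ n → N ≤ n × Σ (Graph n) λ T →
    Caterpillar T × MaxDegAtMost (adj T) Δ ×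
    (∀ k (H : Fin k → Subgraph T) → (∀ i → IsSubtreeMaxDeg d (H i)) → Covers T H →
    ceilDiv (Δ ∸ 2) (d ∸ 2) ≤ k))
mainTheorem15 = upper-bound , lower-bound
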